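{- Let $(G,\sigma)$ be a signed subcubic graph with $|E^-_{(G,\sigma)}|=F(G,\sigma)$. Then for every positive integer $k$: (i) $G$ has no induced subgraph $T$ which is a tree with $v(T)=2k+1$ such that the cut $[V(T),V(T)^c]$ contains at least $k+2$ negative edges; and (ii) $G$ has no induced subgraph $C$ which is a cycle with $v(C)=2k+1$ such that the cut $[V(C),V(C)^c]$ contains at least $k+1$ negative edges.
   Context: A signed graph $(G,\sigma)$ is a graph $G$ with a signature $\sigma:E(G)\to\{+,-\}$; $E^-_{(G,\sigma)}$ is its set of negative edges. For $X\subseteq V(G)$, $[X,X^c]$ denotes the set of edges between $X$ and $V(G)\setminus X$. Switching at an edge cut changes the sign of every edge of the cut; two signatures are switching equivalent if one is obtained from the other by switching at some edge cut. The frustration index is $F(G,\sigma)=\min\{|E^-_{(G,\sigma')}|:\sigma'\text{ switching equivalent to }\sigma\}$. Subcubic means maximum degree at most $3$. -}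

module Defs where

open import Data.Nat using (ℕ; zero; suc; _+_; _≤_)
open import Data.Fin using (Fin; zero; suc; _≟_)
open import Data.Bool using (Bool; true; false; _∧_; _xor_; not; if_then_else_)
open import Data.Product using (_×_; _,_; proj₁; proj₂; ∃; Σ)
open import Data.Sum using (_⊎_)
open import Data.List using (List; []; _∷_)
open import Data.List.Relation.Unary.Unique.Propositional using (Unique)
open import Relation.Binary.PropositionalEquality using (_≡_)
open import Relation.Nullary.Decidable using (⌊_⌋)

-- A finite graph, possibly with parallel edges and loops:
-- vertices Fin n, edges Fin m, each edge has an (unordered) pair of ends.
record Graph : Set where
  field
    n : ℕ
    m : ℕ
    ends : Fin m → Fin n × Fin n

open Graph public

Vertex : Graph → Set
Vertex G = Fin (n G)

Edge : Graph → Set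
Edge G = Fin (m G)

count : ∀ {k} → (Fin k → Bool) → ℕ
count {zero}  p = 0
count {suc k} p = (if p zero then 1 else 0) + count (λ i → p (suc i))

VSet : Graph → Set
VSet G = Vertex G → Bool

-- number of ends of e equal to v (a loop contributes 2)
incid : (G : Graph) → Vertex G → Edge G → ℕ
incid G v e = (if ⌊ proj₁ (ends G e) ≟ v ⌋ then 1 else 0)
            + (if ⌊ proj₂ (ends G e) ≟ v ⌋ then 1 else 0)

sumE : (G : Graph) → (Edge G → ℕ) → ℕ
sumE G f = go (m G) f
  where
  go : (k : ℕ) → (Fin k → ℕ) → ℕ
  go zero    f = 0
  go (suc k) f = f zero + go k (λ i → f (suc i))

degree : (G : Graph) → Vertex G → ℕ
degree G v = sumE G (incid G v)

Subcubic : Graph → Set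
Subcubic G = ∀ v → degree G v ≤ 3

data Sign : Set where
  pos neg : Sign

flipSign : Sign → Sign
flipSign pos = neg
flipSign neg = pos

isNeg : Sign → Bool
isNeg pos = false
isNeg neg = true

Signature : Graph → Set
Signature G = Edge G → Sign

negCount : (G : Graph) → Signature G → ℕ
negCount G σ = count (λ e → isNeg (σ e))

inCut : (G : Graph) → VSet G → Edge G → Bool
inCut G X e = X (proj₁ (ends G e)) xor X (proj₂ (ends G e))

switch : (G : Graph) → Signature G → VSet G → Signature G
switch G σ X e = if inCut G X e then flipSign (σ e) else σ e

SwitchingEquivalent : (G : Graph) → Signature G → Signature G → Set
SwitchingEquivalent G σ σ' = ∃ λ (X : VSet G) → ∀ e → σ' e ≡ switch G σ X e

IsFrustrationIndex : (G : Graph) → Signature G → ℕ → Set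
IsFrustrationIndex G σ f =
  (∃ λ σ' → SwitchingEquivalent G σ σ' × negCount G σ' ≡ f)
  × (∀ σ' → SwitchingEquivalent G σ σ' → f ≤ negCount G σ')

negCut : (G : Graph) → Signature G → VSet G → ℕ
negCut G σ X = count (λ e → inCut G X e ∧ isNeg (σ e))

vcount : (G : Graph) → VSet G → ℕ
vcount G S = count S

Internal : (G : Graph) → VSet G → Edge G → Set
Internal G S e = S (proj₁ (ends G e)) ∧ S (proj₂ (ends G e)) ≡ true

Joins : (G : Graph) → Edge G → Vertex G → Vertex G → Set
Joins G e u w = (ends G e ≡ (u , w)) ⊎ (ends G e ≡ (w , u))

data Walk (G : Graph) (S : VSet G) : Vertex G → Vertex G → List (Edge G) → Set where
  nil  : ∀ {v} → S v ≡ true → Walk G S v v []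
  cons : ∀ {u w x es} (e : Edge G) → Internal G S e → Joins G e u w →
         Walk G S w x es → Walk G S u x (e ∷ es)

Connected : (G : Graph) → VSet G → Set
Connected G S = ∀ u v → S u ≡ true → S v ≡ true → ∃ λ es → Walk G S u v es

Acyclic : (G : Graph) → VSet G → Set
Acyclic G S = ∀ v es → Walk G S v v es → Unique es → es ≡ []

IsInducedTree : (G : Graph) → VSet G → Set
IsInducedTree G S = Connected G S × Acyclic G S

degreeIn : (G : Graph) → VSet G → Vertex G → ℕ
degreeIn G S v = sumE G (λ e → if S (proj₁ (ends G e)) ∧ S (proj₂ (ends G e)) then incid G v e else 0)

IsInducedCycle : (G : Graph) → VSet G → Set
IsInducedCycle G S = Connected G S × (∀ v → S v ≡ true → degreeIn G S v ≡ 2)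

{-# OPTIONS --safe #-}

-- Switching at X turns the negative edges of the cut [X, X^c] positive and vice versa, so when
-- σ already has the fewest negative edges at most half of any cut is negative. Counting
-- incidences, 2 e(X) + |[X, X^c]| is the degree sum over X, hence at most 3 |X| in a subcubic
-- graph. A connected X has e(X) ≥ |X| - 1 and an induced cycle has e(X) = |X|, so the cut has
-- at most |X| + 2, resp. |X|, edges, of which at most k + 1, resp. k, are negative when
-- |X| = 2k + 1.

module Submission where

open import Defs
open import Algebra.Properties.CommutativeSemigroup using (x∙yz≈y∙xz)
open import Data.Bool using (Bool; true; false; _∧_; _∨_; _xor_; not; if_then_else_)
open import Data.Bool.Properties using (∨-identityʳ; ∨-zeroʳ; ∧-conicalʳ; ∧-comm)
open import Data.Empty using (⊥)
open import Data.Fin using (Fin; zero; suc; _≟_)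
open import Data.List using ([]; _∷_)
open import Data.Nat using (ℕ; zero; suc; _+_; _*_; _≤_; _<_; z≤n; s≤s; s<s⁻¹)
open import Data.Nat.Properties hiding (_≟_)
open import Data.Nat.Tactic.RingSolver using (solve)
open import Data.Product using (_×_; _,_; proj₁; proj₂; ∃; map)
open import Data.Sum using (inj₁; inj₂)
open import Function using (_∘_; id)
open import Relation.Nullary using (yes; no; contradiction)
open import Relation.Nullary.Decidable using (⌊_⌋; ⌊⌋-map′)
open import Relation.Binary.PropositionalEquality
open import Algebra.Properties.Semiring.Sum +-*-semiring
  using (sum-syntax; sum-cong-≗; sum-replicate-zero; ∑-distrib-+; ∑-comm; *-distribˡ-sum)

m≤1+o⇒2o+n≤3m⇒n≤m+2 : ∀ {m n o} → m ≤ 1 + o → 2 * o + n ≤ 3 * m → n ≤ m + 2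
m≤1+o⇒2o+n≤3m⇒n≤m+2 {m} {n} {o} m≤1+o 2o+n≤3m = +-cancelˡ-≤ (2 * m) n (m + 2) (begin
  2 * m + n       ≤⟨ +-monoˡ-≤ n (*-monoʳ-≤ 2 m≤1+o) ⟩
  2 * (1 + o) + n ≡⟨ solve (o ∷ n ∷ []) ⟩
  2 + (2 * o + n) ≤⟨ +-monoʳ-≤ 2 2o+n≤3m ⟩
  2 + 3 * m       ≡⟨ solve (m ∷ []) ⟩
  2 * m + (m + 2) ∎)
  where open ≤-Reasoning

2m+n≤3m⇒n≤m : ∀ {m n} → 2 * m + n ≤ 3 * m → n ≤ m
2m+n≤3m⇒n≤m {m} {n} 2m+n≤3m = +-cancelˡ-≤ (2 * m) n m (≤-trans 2m+n≤3m (≤-reflexive (solve (m ∷ []))))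

𝟙 : Bool → ℕ
𝟙 b = if b then 1 else 0

∑-mono-≤ : ∀ {k} {f g : Fin k → ℕ} → (∀ i → f i ≤ g i) → ∑[ i < k ] f i ≤ ∑[ i < k ] g i
∑-mono-≤ {zero}  _   = z≤n
∑-mono-≤ {suc k} f≤g = +-mono-≤ (f≤g zero) (∑-mono-≤ (f≤g ∘ suc))

∑-δ : ∀ {k} (f : Fin k → ℕ) (x : Fin k) → ∑[ i < k ] (f i * 𝟙 ⌊ x ≟ i ⌋) ≡ f x
∑-δ {suc k} f zero = begin
  f zero * 1 + ∑[ i < k ] (f (suc i) * 0) ≡⟨ cong₂ _+_ (*-identityʳ (f zero)) ∑0≡0 ⟩
  f zero + 0                              ≡⟨ +-identityʳ (f zero) ⟩
  f zero                                  ∎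
  where
  open ≡-Reasoning
  ∑0≡0 : ∑[ i < k ] (f (suc i) * 0) ≡ 0
  ∑0≡0 = trans (sum-cong-≗ (*-zeroʳ ∘ f ∘ suc)) (sum-replicate-zero k)
∑-δ {suc k} f (suc x) = begin
  f zero * 0 + ∑[ i < k ] (f (suc i) * 𝟙 ⌊ suc x ≟ suc i ⌋)
    ≡⟨ cong₂ _+_ (*-zeroʳ (f zero)) (sum-cong-≗ λ i → cong (λ b → f (suc i) * 𝟙 b) (⌊⌋-map′ _ _ (x ≟ i))) ⟩
  ∑[ i < k ] (f (suc i) * 𝟙 ⌊ x ≟ i ⌋)
    ≡⟨ ∑-δ (f ∘ suc) x ⟩
  f (suc x) ∎
  where open ≡-Reasoning

count≡∑ : ∀ {k} (p : Fin k → Bool) → count p ≡ ∑[ i < k ] 𝟙 (p i)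
count≡∑ {zero}  p = refl
count≡∑ {suc k} p = cong (𝟙 (p zero) +_) (count≡∑ (p ∘ suc))

count+count≡∑ : ∀ {k} (p q : Fin k → Bool) → count p + count q ≡ ∑[ i < k ] (𝟙 (p i) + 𝟙 (q i))
count+count≡∑ p q = trans (cong₂ _+_ (count≡∑ p) (count≡∑ q)) (sym (∑-distrib-+ (𝟙 ∘ p) (𝟙 ∘ q)))

count-false : ∀ {k} → count {k} (λ _ → false) ≡ 0
count-false {zero}  = refl
count-false {suc k} = count-false {k}

infix 4 _⊆_
_⊆_ : ∀ {k} → (Fin k → Bool) → (Fin k → Bool) → Set
p ⊆ q = ∀ i → p i ≡ true → q i ≡ true

count-mono : ∀ {k} {p q : Fin k → Bool} → p ⊆ q → count p ≤ count q
count-mono {p = p} {q} p⊆q = subst₂ _≤_ (sym (count≡∑ p)) (sym (count≡∑ q)) (∑-mono-≤ 𝟙-mono)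
  where
  𝟙-mono : ∀ i → 𝟙 (p i) ≤ 𝟙 (q i)
  𝟙-mono i with p i in eq
  ... | false = z≤n
  ... | true rewrite p⊆q i eq = ≤-refl

count-nonempty : ∀ {k} (p : Fin k → Bool) → 0 < count p → ∃ λ i → p i ≡ true
count-nonempty {suc k} p 0<|p| with p zero in eq
... | true  = zero , eq
... | false = map suc id (count-nonempty (p ∘ suc) 0<|p|)

count-witness : ∀ {k} (p q : Fin k → Bool) → count p < count q → ∃ λ i → p i ≡ false × q i ≡ true
count-witness {suc k} p q lt with p zero in ep | q zero in eq
... | false | true  = zero , ep , eq
... | false | false = map suc id (count-witness (p ∘ suc) (q ∘ suc) lt)
... | true  | true  = map suc id (count-witness (p ∘ suc) (q ∘ suc) (s<s⁻¹ lt))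
... | true  | false = map suc id (count-witness (p ∘ suc) (q ∘ suc) (<⇒≤ lt))

insert : ∀ {k} → (Fin k → Bool) → Fin k → (Fin k → Bool)
insert p x i = p i ∨ ⌊ x ≟ i ⌋

⊆-insert : ∀ {k} (p : Fin k → Bool) (x : Fin k) → p ⊆ insert p x
⊆-insert p x i pi rewrite pi = refl

∈-insert : ∀ {k} (p : Fin k → Bool) (x : Fin k) → insert p x x ≡ true
∈-insert p x with x ≟ x
... | yes _  = ∨-zeroʳ (p x)
... | no x≢x = contradiction refl x≢x

insert-⊆ : ∀ {k} {p q : Fin k → Bool} {x : Fin k} → p ⊆ q → q x ≡ true → insert p x ⊆ q
insert-⊆ {p = p} {x = x} p⊆q qx i pi∨x≡i with p i in eq | x ≟ i
... | true  | _        = p⊆q i eq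
... | false | yes refl = qx

count-insert : ∀ {k} (p : Fin k → Bool) (x : Fin k) → p x ≡ false → count (insert p x) ≡ suc (count p)
count-insert {k} p x px = begin
  count (insert p x)                                  ≡⟨ count≡∑ (insert p x) ⟩
  ∑[ i < k ] 𝟙 (p i ∨ ⌊ x ≟ i ⌋)                      ≡⟨ sum-cong-≗ split ⟩
  ∑[ i < k ] (𝟙 (p i) + 1 * 𝟙 ⌊ x ≟ i ⌋)              ≡⟨ ∑-distrib-+ (𝟙 ∘ p) (λ i → 1 * 𝟙 ⌊ x ≟ i ⌋) ⟩
  ∑[ i < k ] 𝟙 (p i) + ∑[ i < k ] (1 * 𝟙 ⌊ x ≟ i ⌋)   ≡⟨ cong₂ _+_ (sym (count≡∑ p)) (∑-δ _ x) ⟩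
  count p + 1                                         ≡⟨ +-comm (count p) 1 ⟩
  suc (count p)                                       ∎
  where
  open ≡-Reasoning
  split : ∀ i → 𝟙 (p i ∨ ⌊ x ≟ i ⌋) ≡ 𝟙 (p i) + 1 * 𝟙 ⌊ x ≟ i ⌋
  split i with x ≟ i
  ... | yes refl rewrite px = refl
  ... | no _ = trans (cong 𝟙 (∨-identityʳ (p i))) (sym (+-identityʳ (𝟙 (p i))))

sumE≡∑ : (G : Graph) (f : Edge G → ℕ) → sumE G f ≡ ∑[ e < m G ] f e
sumE≡∑ G = unfold (n G) (m G) (ends G)
  where
  -- sumE recurses through a local helper; generalising over the fields of G exposes that recursion.
  unfold : ∀ n m (ends : Fin m → Fin n × Fin n) (f : Fin m → ℕ) →
           sumE record { n = n ; m = m ; ends = ends } f ≡ ∑[ e < m ] f e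
  unfold n zero    ends f = refl
  unfold n (suc m) ends f = cong (f zero +_) (unfold n m (ends ∘ suc) (f ∘ suc))

𝟙x+𝟙y≡2𝟙[x∧y]+𝟙[x⊕y] : ∀ x y → 𝟙 x + 𝟙 y ≡ 2 * 𝟙 (x ∧ y) + 𝟙 (x xor y)
𝟙x+𝟙y≡2𝟙[x∧y]+𝟙[x⊕y] true  true  = refl
𝟙x+𝟙y≡2𝟙[x∧y]+𝟙[x⊕y] true  false = refl
𝟙x+𝟙y≡2𝟙[x∧y]+𝟙[x⊕y] false true  = refl
𝟙x+𝟙y≡2𝟙[x∧y]+𝟙[x⊕y] false false = refl

𝟙[x∧y]*[𝟙x+𝟙y]≡2𝟙[x∧y] : ∀ x y → 𝟙 (x ∧ y) * (𝟙 x + 𝟙 y) ≡ 2 * 𝟙 (x ∧ y)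
𝟙[x∧y]*[𝟙x+𝟙y]≡2𝟙[x∧y] true  true  = refl
𝟙[x∧y]*[𝟙x+𝟙y]≡2𝟙[x∧y] true  false = refl
𝟙[x∧y]*[𝟙x+𝟙y]≡2𝟙[x∧y] false _     = refl

if-then-0≡𝟙* : ∀ b n → (if b then n else 0) ≡ 𝟙 b * n
if-then-0≡𝟙* true  n = sym (*-identityˡ n)
if-then-0≡𝟙* false n = refl

module _ (G : Graph) where

  end₁ end₂ : Edge G → Vertex G
  end₁ e = proj₁ (ends G e)
  end₂ e = proj₂ (ends G e)

  internal : VSet G → Edge G → Bool
  internal X e = X (end₁ e) ∧ X (end₂ e)

  edgesIn : VSet G → ℕ
  edgesIn X = count (internal X)

  cutSize : VSet G → ℕ
  cutSize X = count (inCut G X)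

  ∑-incid : (X : VSet G) (e : Edge G) →
            ∑[ v < n G ] (𝟙 (X v) * incid G v e) ≡ 𝟙 (X (end₁ e)) + 𝟙 (X (end₂ e))
  ∑-incid X e = begin
    ∑[ v < n G ] (𝟙 (X v) * (𝟙 ⌊ end₁ e ≟ v ⌋ + 𝟙 ⌊ end₂ e ≟ v ⌋))
      ≡⟨ sum-cong-≗ (λ v → *-distribˡ-+ (𝟙 (X v)) _ _) ⟩
    ∑[ v < n G ] (𝟙 (X v) * 𝟙 ⌊ end₁ e ≟ v ⌋ + 𝟙 (X v) * 𝟙 ⌊ end₂ e ≟ v ⌋)
      ≡⟨ ∑-distrib-+ (λ v → 𝟙 (X v) * 𝟙 ⌊ end₁ e ≟ v ⌋) (λ v → 𝟙 (X v) * 𝟙 ⌊ end₂ e ≟ v ⌋) ⟩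
    ∑[ v < n G ] (𝟙 (X v) * 𝟙 ⌊ end₁ e ≟ v ⌋) + ∑[ v < n G ] (𝟙 (X v) * 𝟙 ⌊ end₂ e ≟ v ⌋)
      ≡⟨ cong₂ _+_ (∑-δ (𝟙 ∘ X) (end₁ e)) (∑-δ (𝟙 ∘ X) (end₂ e)) ⟩
    𝟙 (X (end₁ e)) + 𝟙 (X (end₂ e)) ∎
    where open ≡-Reasoning

  ∑-weighted-degree : (X : VSet G) (w : Edge G → ℕ) →
    ∑[ v < n G ] (𝟙 (X v) * ∑[ e < m G ] (w e * incid G v e))
      ≡ ∑[ e < m G ] (w e * (𝟙 (X (end₁ e)) + 𝟙 (X (end₂ e))))
  ∑-weighted-degree X w = begin
    ∑[ v < n G ] (𝟙 (X v) * ∑[ e < m G ] (w e * incid G v e))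
      ≡⟨ sum-cong-≗ (λ v → *-distribˡ-sum (𝟙 (X v)) (λ e → w e * incid G v e)) ⟩
    ∑[ v < n G ] ∑[ e < m G ] (𝟙 (X v) * (w e * incid G v e))
      ≡⟨ ∑-comm (λ v e → 𝟙 (X v) * (w e * incid G v e)) ⟩
    ∑[ e < m G ] ∑[ v < n G ] (𝟙 (X v) * (w e * incid G v e))
      ≡⟨ sum-cong-≗ (λ e → sum-cong-≗ (λ v → x∙yz≈y∙xz *-commutativeSemigroup (𝟙 (X v)) (w e) (incid G v e))) ⟩
    ∑[ e < m G ] ∑[ v < n G ] (w e * (𝟙 (X v) * incid G v e))
      ≡⟨ sum-cong-≗ (λ e → sym (*-distribˡ-sum (w e) (λ v → 𝟙 (X v) * incid G v e))) ⟩
    ∑[ e < m G ] (w e * ∑[ v < n G ] (𝟙 (X v) * incid G v e))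
      ≡⟨ sum-cong-≗ (λ e → cong (w e *_) (∑-incid X e)) ⟩
    ∑[ e < m G ] (w e * (𝟙 (X (end₁ e)) + 𝟙 (X (end₂ e)))) ∎
    where open ≡-Reasoning

  ∑-degree : (X : VSet G) → ∑[ v < n G ] (𝟙 (X v) * degree G v) ≡ 2 * edgesIn X + cutSize X
  ∑-degree X = begin
    ∑[ v < n G ] (𝟙 (X v) * degree G v)
      ≡⟨ sum-cong-≗ (λ v → cong (𝟙 (X v) *_) (degree≡ v)) ⟩
    ∑[ v < n G ] (𝟙 (X v) * ∑[ e < m G ] (1 * incid G v e))
      ≡⟨ ∑-weighted-degree X (λ _ → 1) ⟩
    ∑[ e < m G ] (1 * (𝟙 (X (end₁ e)) + 𝟙 (X (end₂ e))))
      ≡⟨ sum-cong-≗ (λ e → trans (*-identityˡ _) (𝟙x+𝟙y≡2𝟙[x∧y]+𝟙[x⊕y] (X (end₁ e)) (X (end₂ e)))) ⟩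
    ∑[ e < m G ] (2 * 𝟙 (internal X e) + 𝟙 (inCut G X e))
      ≡⟨ ∑-distrib-+ (λ e → 2 * 𝟙 (internal X e)) (𝟙 ∘ inCut G X) ⟩
    ∑[ e < m G ] (2 * 𝟙 (internal X e)) + ∑[ e < m G ] 𝟙 (inCut G X e)
      ≡⟨ cong₂ _+_ (sym (*-distribˡ-sum 2 (𝟙 ∘ internal X))) refl ⟩
    2 * ∑[ e < m G ] 𝟙 (internal X e) + ∑[ e < m G ] 𝟙 (inCut G X e)
      ≡⟨ sym (cong₂ _+_ (cong (2 *_) (count≡∑ (internal X))) (count≡∑ (inCut G X))) ⟩
    2 * edgesIn X + cutSize X ∎
    where
    open ≡-Reasoning
    degree≡ : ∀ v → degree G v ≡ ∑[ e < m G ] (1 * incid G v e)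
    degree≡ v = trans (sumE≡∑ G (incid G v)) (sum-cong-≗ (λ e → sym (*-identityˡ (incid G v e))))

  ∑-degreeIn : (X : VSet G) → ∑[ v < n G ] (𝟙 (X v) * degreeIn G X v) ≡ 2 * edgesIn X
  ∑-degreeIn X = begin
    ∑[ v < n G ] (𝟙 (X v) * degreeIn G X v)
      ≡⟨ sum-cong-≗ (λ v → cong (𝟙 (X v) *_) (degreeIn≡ v)) ⟩
    ∑[ v < n G ] (𝟙 (X v) * ∑[ e < m G ] (𝟙 (internal X e) * incid G v e))
      ≡⟨ ∑-weighted-degree X (𝟙 ∘ internal X) ⟩
    ∑[ e < m G ] (𝟙 (internal X e) * (𝟙 (X (end₁ e)) + 𝟙 (X (end₂ e))))
      ≡⟨ sum-cong-≗ (λ e → 𝟙[x∧y]*[𝟙x+𝟙y]≡2𝟙[x∧y] (X (end₁ e)) (X (end₂ e))) ⟩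
    ∑[ e < m G ] (2 * 𝟙 (internal X e))
      ≡⟨ sym (*-distribˡ-sum 2 (𝟙 ∘ internal X)) ⟩
    2 * ∑[ e < m G ] 𝟙 (internal X e)
      ≡⟨ cong (2 *_) (sym (count≡∑ (internal X))) ⟩
    2 * edgesIn X ∎
    where
    open ≡-Reasoning
    degreeIn≡ : ∀ v → degreeIn G X v ≡ ∑[ e < m G ] (𝟙 (internal X e) * incid G v e)
    degreeIn≡ v = trans (sumE≡∑ G _) (sum-cong-≗ (λ e → if-then-0≡𝟙* (internal X e) (incid G v e)))

  2edgesIn+cutSize≤3count : Subcubic G → (X : VSet G) → 2 * edgesIn X + cutSize X ≤ 3 * count X
  2edgesIn+cutSize≤3count subcubic X = begin
    2 * edgesIn X + cutSize X           ≡⟨ ∑-degree X ⟨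
    ∑[ v < n G ] (𝟙 (X v) * degree G v) ≤⟨ ∑-mono-≤ (λ v → 𝟙*≤3*𝟙 (X v) (subcubic v)) ⟩
    ∑[ v < n G ] (3 * 𝟙 (X v))          ≡⟨ *-distribˡ-sum 3 (𝟙 ∘ X) ⟨
    3 * ∑[ v < n G ] 𝟙 (X v)            ≡⟨ cong (3 *_) (count≡∑ X) ⟨
    3 * count X                         ∎
    where
    open ≤-Reasoning
    𝟙*≤3*𝟙 : ∀ b {d} → d ≤ 3 → 𝟙 b * d ≤ 3 * 𝟙 b
    𝟙*≤3*𝟙 true  d≤3 = ≤-trans (≤-reflexive (*-identityˡ _)) d≤3
    𝟙*≤3*𝟙 false _   = z≤n

  2-regular⇒edgesIn≡count : (X : VSet G) → (∀ v → X v ≡ true → degreeIn G X v ≡ 2) → edgesIn X ≡ count X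
  2-regular⇒edgesIn≡count X regular = *-cancelˡ-≡ (edgesIn X) (count X) 2 (begin
    2 * edgesIn X                           ≡⟨ ∑-degreeIn X ⟨
    ∑[ v < n G ] (𝟙 (X v) * degreeIn G X v) ≡⟨ sum-cong-≗ 𝟙*degreeIn≡2*𝟙 ⟩
    ∑[ v < n G ] (2 * 𝟙 (X v))              ≡⟨ *-distribˡ-sum 2 (𝟙 ∘ X) ⟨
    2 * ∑[ v < n G ] 𝟙 (X v)                ≡⟨ cong (2 *_) (count≡∑ X) ⟨
    2 * count X                             ∎)
    where
    open ≡-Reasoning
    𝟙*degreeIn≡2*𝟙 : ∀ v → 𝟙 (X v) * degreeIn G X v ≡ 2 * 𝟙 (X v)
    𝟙*degreeIn≡2*𝟙 v with X v in eq
    ... | true  = trans (*-identityˡ _) (regular v eq)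
    ... | false = refl

  internal-joins : ∀ {e a b} (X : VSet G) → Joins G e a b → internal X e ≡ X a ∧ X b
  internal-joins X (inj₁ ends≡ab) rewrite ends≡ab = refl
  internal-joins {a = a} {b} X (inj₂ ends≡ba) rewrite ends≡ba = ∧-comm (X b) (X a)

  internal-mono : ∀ {X Y : VSet G} → X ⊆ Y → internal X ⊆ internal Y
  internal-mono {X} X⊆Y e Xe with X (end₁ e) in eq₁ | X (end₂ e) in eq₂
  ... | true | true rewrite X⊆Y _ eq₁ | X⊆Y _ eq₂ = refl

  edgesIn-insert : ∀ {X : VSet G} {e a b} → Joins G e a b → X a ≡ true → X b ≡ false →
                   suc (edgesIn X) ≤ edgesIn (insert X b)
  edgesIn-insert {X} {e} {a} {b} joins Xa Xb = begin
    suc (edgesIn X)               ≡⟨ count-insert (internal X) e e∉X ⟨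
    count (insert (internal X) e) ≤⟨ count-mono (insert-⊆ (internal-mono (⊆-insert X b)) e∈X+b) ⟩
    edgesIn (insert X b)          ∎
    where
    open ≤-Reasoning
    e∉X : internal X e ≡ false
    e∉X rewrite internal-joins X joins | Xa | Xb = refl
    e∈X+b : internal (insert X b) e ≡ true
    e∈X+b rewrite internal-joins (insert X b) joins | ⊆-insert X b a Xa | ∈-insert X b = refl

  record ExitEdge (T R : VSet G) : Set where
    field
      edge        : Edge G
      inner outer : Vertex G
      edge∈T      : Internal G T edge
      joins       : Joins G edge inner outer
      inner∈R     : R inner ≡ true
      outer∉R     : R outer ≡ false

  exitEdge : ∀ {T R : VSet G} {u x es} → Walk G T u x es → R u ≡ true → R x ≡ false → ExitEdge T R
  exitEdge (nil _) u∈R x∉R with () ← trans (sym u∈R) x∉R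
  exitEdge {R = R} (cons {w = w} e e∈T joins walk) u∈R x∉R with R w in w∈R
  ... | true  = exitEdge walk w∈R x∉R
  ... | false = record { edge = e ; edge∈T = e∈T ; joins = joins ; inner∈R = u∈R ; outer∉R = w∈R }

  -- R grows by the outer end of an edge where a walk in T from R to T \ R first leaves R.
  connected⇒spanning : ∀ {T : VSet G} → Connected G T → ∀ j → suc j ≤ count T →
                       ∃ λ R → R ⊆ T × count R ≡ suc j × j ≤ edgesIn R
  connected⇒spanning {T} connected zero 0<|T| with count-nonempty T 0<|T|
  ... | v , v∈T = insert (λ _ → false) v , insert-⊆ (λ _ ()) v∈T ,
                  trans (count-insert (λ _ → false) v refl) (cong suc (count-false {n G})) , z≤n
  connected⇒spanning {T} connected (suc j) j+1<|T| with connected⇒spanning connected j (<⇒≤ j+1<|T|)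
  ... | R , R⊆T , |R|≡1+j , j≤eR
      with count-nonempty R (subst (0 <_) (sym |R|≡1+j) (s≤s z≤n))
         | count-witness R T (subst (_< count T) (sym |R|≡1+j) j+1<|T|)
  ... | r , r∈R | w , w∉R , w∈T with connected r w (R⊆T r r∈R) w∈T
  ... | _ , walk = insert R outer , insert-⊆ R⊆T outer∈T ,
                   trans (count-insert R outer outer∉R) (cong suc |R|≡1+j) ,
                   ≤-trans (s≤s j≤eR) (edgesIn-insert {R} joins inner∈R outer∉R)
    where
    open ExitEdge (exitEdge walk r∈R w∉R)
    outer∈T : T outer ≡ true
    outer∈T = ∧-conicalʳ (T inner) (T outer) (trans (sym (internal-joins T joins)) edge∈T)

  connected⇒count≤1+edgesIn : ∀ {T : VSet G} → Connected G T → count T ≤ suc (edgesIn T)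
  connected⇒count≤1+edgesIn {T} connected with count T in |T|
  ... | zero  = z≤n
  ... | suc j with connected⇒spanning connected j (≤-reflexive (sym |T|))
  ...   | R , R⊆T , _ , j≤eR = s≤s (≤-trans j≤eR (count-mono (internal-mono R⊆T)))

module _ (G : Graph) (σ : Signature G) where

  posCut : VSet G → ℕ
  posCut X = count (λ e → inCut G X e ∧ not (isNeg (σ e)))

  negCount-switch : ∀ X → negCount G (switch G σ X) + negCut G σ X ≡ negCount G σ + posCut X
  negCount-switch X = begin
    negCount G (switch G σ X) + negCut G σ X
      ≡⟨ count+count≡∑ (λ e → isNeg (switch G σ X e)) (λ e → inCut G X e ∧ isNeg (σ e)) ⟩
    ∑[ e < m G ] (𝟙 (isNeg (switch G σ X e)) + 𝟙 (inCut G X e ∧ isNeg (σ e)))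
      ≡⟨ sum-cong-≗ (λ e → trade (inCut G X e) (σ e)) ⟩
    ∑[ e < m G ] (𝟙 (isNeg (σ e)) + 𝟙 (inCut G X e ∧ not (isNeg (σ e))))
      ≡⟨ count+count≡∑ (λ e → isNeg (σ e)) (λ e → inCut G X e ∧ not (isNeg (σ e))) ⟨
    negCount G σ + posCut X ∎
    where
    open ≡-Reasoning
    trade : ∀ c s → 𝟙 (isNeg (if c then flipSign s else s)) + 𝟙 (c ∧ isNeg s)
                  ≡ 𝟙 (isNeg s) + 𝟙 (c ∧ not (isNeg s))
    trade true  pos = refl
    trade true  neg = refl
    trade false pos = refl
    trade false neg = refl

  negCut+posCut≡cutSize : ∀ X → negCut G σ X + posCut X ≡ cutSize G X
  negCut+posCut≡cutSize X = begin
    negCut G σ X + posCut X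
      ≡⟨ count+count≡∑ (λ e → inCut G X e ∧ isNeg (σ e)) (λ e → inCut G X e ∧ not (isNeg (σ e))) ⟩
    ∑[ e < m G ] (𝟙 (inCut G X e ∧ isNeg (σ e)) + 𝟙 (inCut G X e ∧ not (isNeg (σ e))))
      ≡⟨ sum-cong-≗ (λ e → split (inCut G X e) (isNeg (σ e))) ⟩
    ∑[ e < m G ] 𝟙 (inCut G X e)
      ≡⟨ count≡∑ (inCut G X) ⟨
    cutSize G X ∎
    where
    open ≡-Reasoning
    split : ∀ c b → 𝟙 (c ∧ b) + 𝟙 (c ∧ not b) ≡ 𝟙 c
    split true  true  = refl
    split true  false = refl
    split false _     = refl

  module _ (minimal : IsFrustrationIndex G σ (negCount G σ)) where

    negCut≤posCut : ∀ X → negCut G σ X ≤ posCut X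
    negCut≤posCut X = +-cancelˡ-≤ (negCount G (switch G σ X)) _ _ (begin
      negCount G (switch G σ X) + negCut G σ X ≡⟨ negCount-switch X ⟩
      negCount G σ + posCut X                  ≤⟨ +-monoˡ-≤ (posCut X) σ≤switch ⟩
      negCount G (switch G σ X) + posCut X     ∎)
      where
      open ≤-Reasoning
      σ≤switch : negCount G σ ≤ negCount G (switch G σ X)
      σ≤switch = proj₂ minimal (switch G σ X) (X , λ _ → refl)

    2negCut≤cutSize : ∀ X → 2 * negCut G σ X ≤ cutSize G X
    2negCut≤cutSize X = begin
      2 * negCut G σ X            ≡⟨ cong (negCut G σ X +_) (+-identityʳ (negCut G σ X)) ⟩
      negCut G σ X + negCut G σ X ≤⟨ +-monoʳ-≤ (negCut G σ X) (negCut≤posCut X) ⟩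
      negCut G σ X + posCut X     ≡⟨ negCut+posCut≡cutSize X ⟩
      cutSize G X                 ∎
      where open ≤-Reasoning

    2edgesIn+2negCut≤3count : Subcubic G → ∀ X → 2 * edgesIn G X + 2 * negCut G σ X ≤ 3 * count X
    2edgesIn+2negCut≤3count subcubic X =
      ≤-trans (+-monoʳ-≤ (2 * edgesIn G X) (2negCut≤cutSize X)) (2edgesIn+cutSize≤3count G subcubic X)

    connected⇒2negCut≤count+2 : Subcubic G → ∀ {X} → Connected G X → 2 * negCut G σ X ≤ count X + 2
    connected⇒2negCut≤count+2 subcubic {X} connected =
      m≤1+o⇒2o+n≤3m⇒n≤m+2 (connected⇒count≤1+edgesIn G connected) (2edgesIn+2negCut≤3count subcubic X)

    2-regular⇒2negCut≤count : Subcubic G → ∀ {X} → (∀ v → X v ≡ true → degreeIn G X v ≡ 2) →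
                              2 * negCut G σ X ≤ count X
    2-regular⇒2negCut≤count subcubic {X} regular = 2m+n≤3m⇒n≤m
      (subst (λ e → 2 * e + 2 * negCut G σ X ≤ 3 * count X) (2-regular⇒edgesIn≡count G X regular)
             (2edgesIn+2negCut≤3count subcubic X))

lemma2p2 : (G : Graph) (σ : Signature G) → Subcubic G →
           IsFrustrationIndex G σ (negCount G σ) →
           (k : ℕ) → 1 ≤ k →
           ((T : VSet G) → IsInducedTree G T → vcount G T ≡ 2 * k + 1 →
              k + 2 ≤ negCut G σ T → ⊥)
           × ((C : VSet G) → IsInducedCycle G C → vcount G C ≡ 2 * k + 1 →
              k + 1 ≤ negCut G σ C → ⊥)
lemma2p2 G σ subcubic minimal k _ = no-tree , no-cycle
  where
  open ≤-Reasoning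
  no-tree : (T : VSet G) → IsInducedTree G T → vcount G T ≡ 2 * k + 1 → k + 2 ≤ negCut G σ T → ⊥
  no-tree T (connected , _) |T|≡2k+1 k+2≤negCut = 1+n≰n (begin
    suc (2 * k + 1 + 2) ≡⟨ solve (k ∷ []) ⟩
    2 * (k + 2)         ≤⟨ *-monoʳ-≤ 2 k+2≤negCut ⟩
    2 * negCut G σ T    ≤⟨ connected⇒2negCut≤count+2 G σ minimal subcubic connected ⟩
    count T + 2         ≡⟨ cong (_+ 2) |T|≡2k+1 ⟩
    2 * k + 1 + 2       ∎)
  no-cycle : (C : VSet G) → IsInducedCycle G C → vcount G C ≡ 2 * k + 1 → k + 1 ≤ negCut G σ C → ⊥
  no-cycle C (_ , regular) |C|≡2k+1 k+1≤negCut = 1+n≰n (begin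
    suc (2 * k + 1)     ≡⟨ solve (k ∷ []) ⟩
    2 * (k + 1)         ≤⟨ *-monoʳ-≤ 2 k+1≤negCut ⟩
    2 * negCut G σ C    ≤⟨ 2-regular⇒2negCut≤count G σ minimal subcubic regular ⟩
    count C             ≡⟨ |C|≡2k+1 ⟩
    2 * k + 1           ∎)
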